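{- Let $t$ be a positive integer and let $M$ be a $t$-spike with associated partition $(A_1,\dots,A_r)$. Then for every partition $(J,K)$ of $\{1,\dots,r\}$ with $|J|\le|K|$, $$\lambda\Bigl(\bigcup_{j\in J}A_j\Bigr)=\begin{cases}2|J| & \text{if } |J|<t,\\ 2t-2 & \text{if } |J|\ge t.\end{cases}$$
   Context: A matroid $M$ is a $t$-spike of order $r$ (with $r\ge t$) if there is a partition $(A_1,\dots,A_r)$ of $E(M)$ (the associated partition) into 2-element sets such that for every $t$-element $J\subseteq\{1,\dots,r\}$, the set $\bigcup_{j\in J}A_j$ is both a circuit and a cocircuit of $M$. The connectivity function of $M$ is $\lambda(X)=r(X)+r(E(M)-X)-r(M)$ for $X\subseteq E(M)$. -}

module Defs where

open import Data.Nat using (ℕ; _+_; _∸_; _<_; _≤_)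
open import Data.Bool using (Bool)
open import Data.Fin using (Fin; _≟_)
open import Data.Fin.Subset using (Subset; ⊤; ∁; _∩_; _∪_; _⊆_; _⊂_; ∣_∣)
open import Data.Vec using (tabulate; lookup)
open import Relation.Nullary.Decidable using (⌊_⌋)
open import Relation.Binary.PropositionalEquality using (_≡_)
open import Data.Product using (_×_)

record Matroid (n : ℕ) : Set where
  field
    rank       : Subset n → ℕ
    rank-bound : ∀ X → rank X ≤ ∣ X ∣
    rank-mono  : ∀ X Y → X ⊆ Y → rank X ≤ rank Y
    rank-submod : ∀ X Y → rank (X ∪ Y) + rank (X ∩ Y) ≤ rank X + rank Y
open Matroid public

IsCircuitOf : {n : ℕ} → (Subset n → ℕ) → Subset n → Set
IsCircuitOf rk C = (rk C < ∣ C ∣) × (∀ Y → Y ⊂ C → rk Y ≡ ∣ Y ∣)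

dualRank : {n : ℕ} → Matroid n → Subset n → ℕ
dualRank M X = ∣ X ∣ + rank M (∁ X) ∸ rank M ⊤

IsCircuit : {n : ℕ} → Matroid n → Subset n → Set
IsCircuit M = IsCircuitOf (rank M)

IsCocircuit : {n : ℕ} → Matroid n → Subset n → Set
IsCocircuit M = IsCircuitOf (dualRank M)

-- Connectivity function λ(X) = r(X) + r(E − X) − r(M)  (the subtraction
-- never truncates, by submodularity).
conn : {n : ℕ} → Matroid n → Subset n → ℕ
conn M X = rank M X + rank M (∁ X) ∸ rank M ⊤

-- A partition of E = Fin n into blocks A_1..A_r is given by the map
-- p : Fin n → Fin r sending an element to the index of its block.
-- Block A_i:
block : {n r : ℕ} → (Fin n → Fin r) → Fin r → Subset n
block p i = tabulate (λ e → ⌊ p e ≟ i ⌋)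

blockUnion : {n r : ℕ} → (Fin n → Fin r) → Subset r → Subset n
blockUnion p J = tabulate (λ e → lookup J (p e))

IsSpike : {n : ℕ} → (t r : ℕ) → Matroid n → (Fin n → Fin r) → Set
IsSpike t r M p =
  (∀ i → ∣ block p i ∣ ≡ 2) ×
  (t ≤ r) ×
  (∀ J → ∣ J ∣ ≡ t → IsCircuit M (blockUnion p J) × IsCocircuit M (blockUnion p J))

-- Write ⟦ L ⟧ for the union of the blocks indexed by L ⊆ {1..r} and
-- ρ L = r(⟦ L ⟧).  Every block has two elements, so ∣ ⟦ L ⟧ ∣ = 2∣L∣.
--   * If ∣L∣ < t, then L lies in a t-set S and ⟦ L ⟧ is a proper subset of
--     the circuit and cocircuit ⟦ S ⟧: hence ρ L = 2∣L∣ and ⟦ L ⟧ has a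
--     spanning complement.  This settles the case ∣J∣ < t.
--   * Adding one block to a set of at least u blocks raises ρ by at most
--     one (submodularity against a circuit ⟦ J₀ ∪ {j} ⟧ with J₀ ⊆ L of size
--     u), and by at least one as long as u blocks remain outside
--     (submodularity against the cocircuit ⟦ D₀ ∪ {j} ⟧ with D₀ of size u
--     disjoint from L).  Starting from ρ L = 2u at ∣L∣ = u this gives
--     ρ L = ∣L∣ + u whenever u ≤ ∣L∣ ≤ r − u, and in particular r(M) = r.
--   * For ∣J∣ ≥ t both J and its complement K satisfy these bounds, so
--     λ = (∣J∣ + u) + (∣K∣ + u) − r = 2u = 2t − 2.
-- The file develops, in order: arithmetic and finite-set combinatorics,
-- general rank inequalities for circuits and cocircuits of a matroid,
-- unions of blocks of a partition, the rank function of a spike, and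
-- finally the theorem.
module Submission where

open import Defs
open import Data.Nat using (ℕ; zero; suc; _+_; _*_; _∸_; _<_; _≤_; z≤n; s≤s)
open import Data.Nat.Properties hiding (_≟_)
open import Data.Nat.Tactic.RingSolver using (solve-∀)
open import Data.Bool using (true; false; not)
open import Data.Bool.Properties using (T-≡)
open import Data.Fin using (Fin; suc; _≟_)
open import Data.Fin.Subset
open import Data.Fin.Subset.Properties
open import Data.Vec using ([]; _∷_; here; there; lookup)
open import Data.Vec.Properties using (lookup∘tabulate; []=⇒lookup; lookup⇒[]=; lookup-map; tabulate-cong; tabulate-∘)
open import Data.Product using (∃-syntax; _×_; _,_; proj₁; proj₂)
open import Data.Sum using (inj₁; inj₂)
open import Function using (_∘_)
open import Function.Bundles using (Equivalence)
open import Relation.Nullary using (yes; no; contradiction)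
open import Relation.Nullary.Decidable using (fromWitness; toWitness)
open import Relation.Binary.PropositionalEquality

a+b∸c≡a⇒c≤b : ∀ a b c → 0 < a → a + b ∸ c ≡ a → c ≤ b
a+b∸c≡a⇒c≤b a b c 0<a eq with c ≤? a + b
... | yes c≤a+b = ≤-reflexive (+-cancelˡ-≡ a c b (trans (cong (_+ c) (sym eq)) (m∸n+n≡m c≤a+b)))
... | no c≰a+b = contradiction (trans (sym (m≤n⇒m∸n≡0 (<⇒≤ (≰⇒> c≰a+b)))) eq) (<⇒≢ 0<a)

a+b∸c<a⇒b<c : ∀ a b c → a + b ∸ c < a → b < c
a+b∸c<a⇒b<c a b c lt with c ≤? b
... | yes c≤b = contradiction (subst (a ≤_) (sym (+-∸-assoc a c≤b)) (m≤m+n a (b ∸ c))) (<⇒≱ lt)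
... | no c≰b = ≰⇒> c≰b

x+2u<y+2[1+u]⇒x≤1+y : ∀ x y u → x + 2 * u < y + 2 * suc u → x ≤ suc y
x+2u<y+2[1+u]⇒x≤1+y x y u lt =
  ≤-pred (+-cancelʳ-< (2 * u) x (suc (suc y)) (subst (x + 2 * u <_) (rearrange y u) lt))
  where
  rearrange : ∀ y u → y + 2 * suc u ≡ suc (suc y) + 2 * u
  rearrange = solve-∀

connectivity-arith : ∀ a b u → (a + u) + (b + u) ∸ (a + b) ≡ 2 * suc u ∸ 2
connectivity-arith a b u = begin
  (a + u) + (b + u) ∸ (a + b) ≡⟨ cong (_∸ (a + b)) (regroup a b u) ⟩
  (u + u) + (a + b) ∸ (a + b) ≡⟨ m+n∸n≡m (u + u) (a + b) ⟩
  u + u                       ≡⟨ sym (m+n∸m≡n 2 (u + u)) ⟩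
  2 + (u + u) ∸ 2             ≡⟨ cong (_∸ 2) (double u) ⟩
  2 * suc u ∸ 2               ∎
  where
  open ≡-Reasoning
  regroup : ∀ a b u → (a + u) + (b + u) ≡ (u + u) + (a + b)
  regroup = solve-∀
  double : ∀ u → 2 + (u + u) ≡ 2 * suc u
  double = solve-∀

nonempty-of-size : ∀ {m} {p : Subset m} → 0 < ∣ p ∣ → Nonempty p
nonempty-of-size {m} {p} 0<∣p∣ with nonempty? p
... | yes ne = ne
... | no empty = contradiction (trans (cong ∣_∣ (Empty-unique empty)) (∣⊥∣≡0 m)) (≢-sym (<⇒≢ 0<∣p∣))

size-of-member : ∀ {m} {x : Fin m} {p : Subset m} → x ∈ p → 0 < ∣ p ∣
size-of-member {x = x} {p} x∈p = subst (_≤ ∣ p ∣) (∣⁅x⁆∣≡1 x) (p⊆q⇒∣p∣≤∣q∣ ⁅x⁆⊆p)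
  where
  ⁅x⁆⊆p : ⁅ x ⁆ ⊆ p
  ⁅x⁆⊆p y∈⁅x⁆ = subst (_∈ p) (sym (x∈⁅y⁆⇒x≡y x y∈⁅x⁆)) x∈p

∣p-x∣+1≡∣p∣ : ∀ {m} {x : Fin m} {p : Subset m} → x ∈ p → suc ∣ p - x ∣ ≡ ∣ p ∣
∣p-x∣+1≡∣p∣ {p = true ∷ p} here = cong (suc ∘ ∣_∣) (p─⊥≡p p)
∣p-x∣+1≡∣p∣ {p = true ∷ p} (there x∈p) = cong suc (∣p-x∣+1≡∣p∣ x∈p)
∣p-x∣+1≡∣p∣ {p = false ∷ p} (there x∈p) = ∣p-x∣+1≡∣p∣ x∈p

x∉p-x : ∀ {m} (p : Subset m) (x : Fin m) → x ∉ p - x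
x∉p-x (s ∷ p) (suc x) (there x∈p-x) = x∉p-x p x x∈p-x

p⊆[p-x]∪q : ∀ {m} {x : Fin m} {p q : Subset m} → x ∈ q → p ⊆ (p - x) ∪ q
p⊆[p-x]∪q {x = x} x∈q {y} y∈p with y ≟ x
... | yes refl = x∈p∪q⁺ (inj₂ x∈q)
... | no y≢x = x∈p∪q⁺ (inj₁ (x∈p∧x≢y⇒x∈p-y y∈p y≢x))

∣p∪q∣≡∣p∣+∣q∣ : ∀ {m} (p q : Subset m) → (∀ {x} → x ∈ p → x ∉ q) → ∣ p ∪ q ∣ ≡ ∣ p ∣ + ∣ q ∣
∣p∪q∣≡∣p∣+∣q∣ [] [] _ = refl
∣p∪q∣≡∣p∣+∣q∣ (true ∷ p) (true ∷ q) disj = contradiction here (disj here)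
∣p∪q∣≡∣p∣+∣q∣ (true ∷ p) (false ∷ q) disj =
  cong suc (∣p∪q∣≡∣p∣+∣q∣ p q (λ x∈p x∈q → disj (there x∈p) (there x∈q)))
∣p∪q∣≡∣p∣+∣q∣ (false ∷ p) (true ∷ q) disj =
  trans (cong suc (∣p∪q∣≡∣p∣+∣q∣ p q (λ x∈p x∈q → disj (there x∈p) (there x∈q)))) (sym (+-suc _ _))
∣p∪q∣≡∣p∣+∣q∣ (false ∷ p) (false ∷ q) disj =
  ∣p∪q∣≡∣p∣+∣q∣ p q (λ x∈p x∈q → disj (there x∈p) (there x∈q))

∣p∪⁅x⁆∣≡1+∣p∣ : ∀ {m} {x : Fin m} (p : Subset m) → x ∉ p → ∣ p ∪ ⁅ x ⁆ ∣ ≡ suc ∣ p ∣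
∣p∪⁅x⁆∣≡1+∣p∣ {x = x} p x∉p = begin
  ∣ p ∪ ⁅ x ⁆ ∣     ≡⟨ ∣p∪q∣≡∣p∣+∣q∣ p ⁅ x ⁆ (λ y∈p y∈⁅x⁆ → x∉p (subst (_∈ p) (x∈⁅y⁆⇒x≡y x y∈⁅x⁆) y∈p)) ⟩
  ∣ p ∣ + ∣ ⁅ x ⁆ ∣ ≡⟨ cong (∣ p ∣ +_) (∣⁅x⁆∣≡1 x) ⟩
  ∣ p ∣ + 1         ≡⟨ +-comm ∣ p ∣ 1 ⟩
  suc ∣ p ∣         ∎
  where open ≡-Reasoning

∣p∣+∣∁p∣≡n : ∀ {m} (p : Subset m) → ∣ p ∣ + ∣ ∁ p ∣ ≡ m
∣p∣+∣∁p∣≡n p = trans (cong (∣ p ∣ +_) (∣∁p∣≡n∸∣p∣ p)) (m+[n∸m]≡n (∣p∣≤n p))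

⊆∧∣<∣⇒⊂ : ∀ {m} {p q : Subset m} → p ⊆ q → ∣ p ∣ < ∣ q ∣ → p ⊂ q
⊆∧∣<∣⇒⊂ {p = p} {q} p⊆q ∣p∣<∣q∣ with p ⊂? q
... | yes p⊂q = p⊂q
... | no p⊄q = contradiction (p⊆q⇒∣p∣≤∣q∣ q⊆p) (<⇒≱ ∣p∣<∣q∣)
  where
  q⊆p : q ⊆ p
  q⊆p {x} x∈q with x ∈? p
  ... | yes x∈p = x∈p
  ... | no x∉p = contradiction ((λ {y} → p⊆q {y}) , x , x∈q , x∉p) p⊄q

subset-of-size : ∀ {m} k (q : Subset m) → k ≤ ∣ q ∣ → ∃[ p ] p ⊆ q × ∣ p ∣ ≡ k
subset-of-size {m} zero q _ = ⊥ , ⊥⊆ , ∣⊥∣≡0 m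
subset-of-size (suc k) (true ∷ q) (s≤s k≤∣q∣) with subset-of-size k q k≤∣q∣
... | p , p⊆q , ∣p∣≡k = true ∷ p , s⊆s p⊆q , cong suc ∣p∣≡k
subset-of-size (suc k) (false ∷ q) k<∣q∣ with subset-of-size (suc k) q k<∣q∣
... | p , p⊆q , ∣p∣≡k = false ∷ p , out⊆ p⊆q , ∣p∣≡k

removal-induction : ∀ {m} (u : ℕ) (P : Subset m → Set) →
  (∀ L → ∣ L ∣ ≡ u → P L) →
  (∀ L x → x ∈ L → u ≤ ∣ L - x ∣ → P (L - x) → P L) →
  ∀ L → u ≤ ∣ L ∣ → P L
removal-induction u P base step L u≤∣L∣ = go (∣ L ∣ ∸ u) L (m∸n+n≡m u≤∣L∣)
  where
  go : ∀ k L → k + u ≡ ∣ L ∣ → P L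
  go zero L k+u≡∣L∣ = base L (sym k+u≡∣L∣)
  go (suc k) L k+u≡∣L∣ with nonempty-of-size {p = L} (subst (0 <_) k+u≡∣L∣ (s≤s z≤n))
  ... | x , x∈L = step L x x∈L (subst (u ≤_) size (m≤n+m u k)) (go k (L - x) size)
    where
    size : k + u ≡ ∣ L - x ∣
    size = suc-injective (trans k+u≡∣L∣ (sym (∣p-x∣+1≡∣p∣ x∈L)))

-- Rank inequalities coming from a single circuit or cocircuit of M.
module _ {n : ℕ} (M : Matroid n) where

  -- A circuit C together with a set X meeting it in at least Z ⊂ C:
  -- submodularity and the independence of Z give
  -- r(Y) + ∣Z∣ < r(X) + ∣C∣ for every Y ⊆ X ∪ C.
  circuit-rank-bound : ∀ {C Z X Y} → IsCircuit M C → Z ⊂ C → Z ⊆ X → Y ⊆ X ∪ C →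
    rank M Y + ∣ Z ∣ < rank M X + ∣ C ∣
  circuit-rank-bound {C} {Z} {X} {Y} (dependent , proper-independent) Z⊂C Z⊆X Y⊆X∪C = begin-strict
    rank M Y + ∣ Z ∣                ≡⟨ cong (rank M Y +_) (sym (proper-independent Z Z⊂C)) ⟩
    rank M Y + rank M Z             ≤⟨ +-mono-≤ (rank-mono M Y (X ∪ C) Y⊆X∪C) (rank-mono M Z (X ∩ C) Z⊆X∩C) ⟩
    rank M (X ∪ C) + rank M (X ∩ C) ≤⟨ rank-submod M X C ⟩
    rank M X + rank M C             <⟨ +-monoʳ-< (rank M X) dependent ⟩
    rank M X + ∣ C ∣                ∎
    where
    open ≤-Reasoning
    Z⊆X∩C : Z ⊆ X ∩ C
    Z⊆X∩C z∈Z = x∈p∩q⁺ (Z⊆X z∈Z , proj₁ Z⊂C z∈Z)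

  cocircuit-complement-rank : ∀ {D} → IsCocircuit M D → rank M (∁ D) < rank M ⊤
  cocircuit-complement-rank {D} (dependent , _) = a+b∸c<a⇒b<c ∣ D ∣ _ _ dependent

  cocircuit-proper-subset-spanning : ∀ {D W} → IsCocircuit M D → W ⊂ D → rank M (∁ W) ≡ rank M ⊤
  cocircuit-proper-subset-spanning {D} {W} (_ , proper-independent) W⊂D =
    ≤-antisym (rank-mono M (∁ W) ⊤ ⊆⊤) ⊤≤∁W
    where
    ⊤≤∁W : rank M ⊤ ≤ rank M (∁ W)
    ⊤≤∁W with nonempty? W
    ... | yes (_ , x∈W) = a+b∸c≡a⇒c≤b ∣ W ∣ _ _ (size-of-member x∈W) (proper-independent W W⊂D)
    ... | no empty = rank-mono M ⊤ (∁ W) (λ {x} _ → x∉p⇒x∈∁p (λ x∈W → empty (x , x∈W)))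

  -- Removing a cocircuit D from a set X that meets it lowers the rank:
  -- X ∪ (E − D) is spanning, so submodularity against E − D applies.
  cocircuit-rank-drop : ∀ {D X Y e} → IsCocircuit M D → e ∈ X → e ∈ D →
    Y ⊆ X → (∀ {y} → y ∈ Y → y ∉ D) → rank M Y < rank M X
  cocircuit-rank-drop {D} {X} {Y} {e} cocircuit e∈X e∈D Y⊆X Y-misses-D =
    +-cancelʳ-< (rank M ⊤) (rank M Y) (rank M X) (begin-strict
      rank M Y + rank M ⊤               ≤⟨ +-mono-≤ (rank-mono M Y (X ∩ ∁ D) Y⊆X∖D) ⊤≤X∪∁D ⟩
      rank M (X ∩ ∁ D) + rank M (X ∪ ∁ D) ≡⟨ +-comm (rank M (X ∩ ∁ D)) (rank M (X ∪ ∁ D)) ⟩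
      rank M (X ∪ ∁ D) + rank M (X ∩ ∁ D) ≤⟨ rank-submod M X (∁ D) ⟩
      rank M X + rank M (∁ D)           <⟨ +-monoʳ-< (rank M X) (cocircuit-complement-rank cocircuit) ⟩
      rank M X + rank M ⊤               ∎)
    where
    open ≤-Reasoning
    W : Subset n
    W = ∁ X ∩ D
    W⊂D : W ⊂ D
    W⊂D = p∩q⊆q (∁ X) D , e , e∈D , λ e∈W → x∈∁p⇒x∉p (proj₁ (x∈p∩q⁻ (∁ X) D e∈W)) e∈X
    ∁W⊆X∪∁D : ∁ W ⊆ X ∪ ∁ D
    ∁W⊆X∪∁D {x} x∈∁W with x ∈? X
    ... | yes x∈X = x∈p∪q⁺ (inj₁ x∈X)
    ... | no x∉X = x∈p∪q⁺ (inj₂ (x∉p⇒x∈∁p λ x∈D → x∈∁p⇒x∉p x∈∁W (x∈p∩q⁺ (x∉p⇒x∈∁p x∉X , x∈D))))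
    ⊤≤X∪∁D : rank M ⊤ ≤ rank M (X ∪ ∁ D)
    ⊤≤X∪∁D = subst (_≤ rank M (X ∪ ∁ D)) (cocircuit-proper-subset-spanning cocircuit W⊂D)
               (rank-mono M (∁ W) (X ∪ ∁ D) ∁W⊆X∪∁D)
    Y⊆X∖D : Y ⊆ X ∩ ∁ D
    Y⊆X∖D y∈Y = x∈p∩q⁺ (Y⊆X y∈Y , x∉p⇒x∈∁p (Y-misses-D y∈Y))

module _ {n r : ℕ} (p : Fin n → Fin r) where

  ∈-blockUnion⁺ : ∀ {A e} → p e ∈ A → e ∈ blockUnion p A
  ∈-blockUnion⁺ {A} {e} pe∈A =
    lookup⇒[]= e (blockUnion p A) (trans (lookup∘tabulate _ e) ([]=⇒lookup pe∈A))

  ∈-blockUnion⁻ : ∀ {A e} → e ∈ blockUnion p A → p e ∈ A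
  ∈-blockUnion⁻ {A} {e} e∈⋃A =
    lookup⇒[]= (p e) A (trans (sym (lookup∘tabulate _ e)) ([]=⇒lookup e∈⋃A))

  ∈-block⁺ : ∀ {i e} → p e ≡ i → e ∈ block p i
  ∈-block⁺ {i} {e} pe≡i = lookup⇒[]= e (block p i)
    (trans (lookup∘tabulate _ e) (Equivalence.to T-≡ (fromWitness {a? = p e ≟ i} pe≡i)))

  ∈-block⁻ : ∀ {i e} → e ∈ block p i → p e ≡ i
  ∈-block⁻ {i} {e} e∈Ai = toWitness {a? = p e ≟ i}
    (Equivalence.from T-≡ (trans (sym (lookup∘tabulate _ e)) ([]=⇒lookup e∈Ai)))

  blockUnion-mono : ∀ {A B} → A ⊆ B → blockUnion p A ⊆ blockUnion p B
  blockUnion-mono A⊆B = ∈-blockUnion⁺ ∘ A⊆B ∘ ∈-blockUnion⁻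

  blockUnion-∪ : ∀ A B → blockUnion p (A ∪ B) ⊆ blockUnion p A ∪ blockUnion p B
  blockUnion-∪ A B e∈ with x∈p∪q⁻ A B (∈-blockUnion⁻ e∈)
  ... | inj₁ pe∈A = x∈p∪q⁺ (inj₁ (∈-blockUnion⁺ pe∈A))
  ... | inj₂ pe∈B = x∈p∪q⁺ (inj₂ (∈-blockUnion⁺ pe∈B))

  blockUnion-∁ : ∀ A → blockUnion p (∁ A) ≡ ∁ (blockUnion p A)
  blockUnion-∁ A = trans (tabulate-cong (λ e → lookup-map (p e) not A)) (tabulate-∘ not (lookup A ∘ p))

  blockUnion-split : ∀ {A i} → i ∈ A → blockUnion p A ≡ blockUnion p (A - i) ∪ block p i
  blockUnion-split {A} {i} i∈A = ⊆-antisym split join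
    where
    split : blockUnion p A ⊆ blockUnion p (A - i) ∪ block p i
    split {e} e∈ with p e ≟ i
    ... | yes pe≡i = x∈p∪q⁺ (inj₂ (∈-block⁺ pe≡i))
    ... | no pe≢i = x∈p∪q⁺ (inj₁ (∈-blockUnion⁺ (x∈p∧x≢y⇒x∈p-y {p = A} (∈-blockUnion⁻ e∈) pe≢i)))
    join : blockUnion p (A - i) ∪ block p i ⊆ blockUnion p A
    join {e} e∈ with x∈p∪q⁻ (blockUnion p (A - i)) (block p i) e∈
    ... | inj₁ e∈⋃A-i = blockUnion-mono (p─q⊆p A ⁅ i ⁆) e∈⋃A-i
    ... | inj₂ e∈Ai = ∈-blockUnion⁺ (subst (_∈ A) (sym (∈-block⁻ e∈Ai)) i∈A)

  ∣blockUnion∣ : ∀ {b} → (∀ i → ∣ block p i ∣ ≡ b) → ∀ A → ∣ blockUnion p A ∣ ≡ b * ∣ A ∣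
  ∣blockUnion∣ {b} ∣blocks∣ A = removal-induction 0 P base step A z≤n
    where
    P : Subset r → Set
    P A = ∣ blockUnion p A ∣ ≡ b * ∣ A ∣
    base : ∀ A → ∣ A ∣ ≡ 0 → P A
    base A ∣A∣≡0 = begin
      ∣ blockUnion p A ∣ ≡⟨ cong ∣_∣ (Empty-unique λ (_ , e∈) → <⇒≢ (size-of-member (∈-blockUnion⁻ {A} e∈)) (sym ∣A∣≡0)) ⟩
      ∣ ⊥ {n} ∣         ≡⟨ ∣⊥∣≡0 n ⟩
      0                 ≡⟨ sym (*-zeroʳ b) ⟩
      b * 0             ≡⟨ cong (b *_) (sym ∣A∣≡0) ⟩
      b * ∣ A ∣         ∎
      where open ≡-Reasoning
    step : ∀ A i → i ∈ A → 0 ≤ ∣ A - i ∣ → P (A - i) → P A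
    step A i i∈A _ ih = begin
      ∣ blockUnion p A ∣                                ≡⟨ cong ∣_∣ (blockUnion-split i∈A) ⟩
      ∣ blockUnion p (A - i) ∪ block p i ∣              ≡⟨ ∣p∪q∣≡∣p∣+∣q∣ _ _ disjoint ⟩
      ∣ blockUnion p (A - i) ∣ + ∣ block p i ∣          ≡⟨ cong₂ _+_ ih (∣blocks∣ i) ⟩
      b * ∣ A - i ∣ + b                                 ≡⟨ +-comm (b * ∣ A - i ∣) b ⟩
      b + b * ∣ A - i ∣                                 ≡⟨ sym (*-suc b ∣ A - i ∣) ⟩
      b * suc ∣ A - i ∣                                 ≡⟨ cong (b *_) (∣p-x∣+1≡∣p∣ i∈A) ⟩
      b * ∣ A ∣                                         ∎
      where
      open ≡-Reasoning
      disjoint : ∀ {e} → e ∈ blockUnion p (A - i) → e ∉ block p i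
      disjoint e∈⋃A-i e∈Ai = x∉p-x A i (subst (_∈ A - i) (∈-block⁻ e∈Ai) (∈-blockUnion⁻ e∈⋃A-i))

module SpikeRank (u : ℕ) {r n : ℕ} (M : Matroid n) (p : Fin n → Fin r)
                 (spike : IsSpike (suc u) r M p) where

  ⟦_⟧ : Subset r → Subset n
  ⟦ L ⟧ = blockUnion p L

  ρ : Subset r → ℕ
  ρ L = rank M ⟦ L ⟧

  t≤r : suc u ≤ r
  t≤r = proj₁ (proj₂ spike)

  t-set : ∀ S → ∣ S ∣ ≡ suc u → IsCircuit M ⟦ S ⟧ × IsCocircuit M ⟦ S ⟧
  t-set = proj₂ (proj₂ spike)

  ∣⟦_⟧∣ : ∀ L → ∣ ⟦ L ⟧ ∣ ≡ 2 * ∣ L ∣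
  ∣⟦_⟧∣ = ∣blockUnion∣ p (proj₁ spike)

  ∣⟦⟧∣-of-size : ∀ S {k} → ∣ S ∣ ≡ k → ∣ ⟦ S ⟧ ∣ ≡ 2 * k
  ∣⟦⟧∣-of-size S ∣S∣≡k = trans ∣⟦ S ⟧∣ (cong (2 *_) ∣S∣≡k)

  ⟦⟧-proper : ∀ A {B} → A ⊆ B → ∣ A ∣ < ∣ B ∣ → ⟦ A ⟧ ⊂ ⟦ B ⟧
  ⟦⟧-proper A {B} A⊆B ∣A∣<∣B∣ = ⊆∧∣<∣⇒⊂ (blockUnion-mono p {A = A} A⊆B)
    (subst₂ _<_ (sym ∣⟦ A ⟧∣) (sym ∣⟦ B ⟧∣) (*-monoʳ-< 2 ∣A∣<∣B∣))

  block-element : ∀ j → ∃[ e ] p e ≡ j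
  block-element j with nonempty-of-size {p = block p j} (subst (0 <_) (sym (proj₁ spike j)) (s≤s z≤n))
  ... | e , e∈Aj = e , ∈-block⁻ p e∈Aj

  insert-size : ∀ {S : Subset r} {j} → ∣ S ∣ ≡ u → j ∉ S → ∣ S ∪ ⁅ j ⁆ ∣ ≡ suc u
  insert-size {S} ∣S∣≡u j∉S = trans (∣p∪⁅x⁆∣≡1+∣p∣ S j∉S) (cong suc ∣S∣≡u)

  proper-in-t-set : ∀ J → ∣ J ∣ < suc u → ∃[ S ] ∣ S ∣ ≡ suc u × ⟦ J ⟧ ⊂ ⟦ S ⟧
  proper-in-t-set J J<t with subset-of-size (suc u ∸ ∣ J ∣) (∁ J) room
    where
    room : suc u ∸ ∣ J ∣ ≤ ∣ ∁ J ∣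
    room = subst (suc u ∸ ∣ J ∣ ≤_) (sym (∣∁p∣≡n∸∣p∣ J)) (∸-monoˡ-≤ ∣ J ∣ t≤r)
  ... | T , T⊆∁J , ∣T∣ = J ∪ T , ∣J∪T∣ , ⟦⟧-proper J (p⊆p∪q T) (subst (∣ J ∣ <_) (sym ∣J∪T∣) J<t)
    where
    ∣J∪T∣ : ∣ J ∪ T ∣ ≡ suc u
    ∣J∪T∣ = trans (∣p∪q∣≡∣p∣+∣q∣ J T (λ x∈J x∈T → x∈∁p⇒x∉p (T⊆∁J x∈T) x∈J))
                  (trans (cong (∣ J ∣ +_) ∣T∣) (m+[n∸m]≡n (<⇒≤ J<t)))

  independent-below-t : ∀ J → ∣ J ∣ < suc u → ρ J ≡ 2 * ∣ J ∣
  independent-below-t J J<t with proper-in-t-set J J<t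
  ... | S , ∣S∣ , ⟦J⟧⊂⟦S⟧ = trans (proj₂ (proj₁ (t-set S ∣S∣)) ⟦ J ⟧ ⟦J⟧⊂⟦S⟧) ∣⟦ J ⟧∣

  spanning-below-t : ∀ J → ∣ J ∣ < suc u → rank M (∁ ⟦ J ⟧) ≡ rank M ⊤
  spanning-below-t J J<t with proper-in-t-set J J<t
  ... | S , ∣S∣ , ⟦J⟧⊂⟦S⟧ = cocircuit-proper-subset-spanning M (proj₂ (t-set S ∣S∣)) ⟦J⟧⊂⟦S⟧

  -- Growing a set of at least u blocks by one block raises ρ by at most one:
  -- take a u-subset J₀ of L - j; then J₀ ∪ {j} indexes a circuit.
  rank-step-≤1 : ∀ L {j} → j ∈ L → u ≤ ∣ L - j ∣ → ρ L ≤ suc (ρ (L - j))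
  rank-step-≤1 L {j} j∈L u≤∣L-j∣ with subset-of-size u (L - j) u≤∣L-j∣
  ... | J₀ , J₀⊆L-j , ∣J₀∣ = x+2u<y+2[1+u]⇒x≤1+y (ρ L) (ρ (L - j)) u
          (subst₂ (λ z c → ρ L + z < ρ (L - j) + c) (∣⟦⟧∣-of-size J₀ ∣J₀∣) (∣⟦⟧∣-of-size C ∣C∣)
            (circuit-rank-bound M (proj₁ (t-set C ∣C∣)) ⟦J₀⟧⊂⟦C⟧ (blockUnion-mono p J₀⊆L-j) ⟦L⟧⊆))
    where
    C : Subset r
    C = J₀ ∪ ⁅ j ⁆
    ∣C∣ : ∣ C ∣ ≡ suc u
    ∣C∣ = insert-size ∣J₀∣ (λ j∈J₀ → x∉p-x L j (J₀⊆L-j j∈J₀))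
    ⟦J₀⟧⊂⟦C⟧ : ⟦ J₀ ⟧ ⊂ ⟦ C ⟧
    ⟦J₀⟧⊂⟦C⟧ = ⟦⟧-proper J₀ (p⊆p∪q ⁅ j ⁆) (subst₂ _<_ (sym ∣J₀∣) (sym ∣C∣) ≤-refl)
    ⟦L⟧⊆ : ⟦ L ⟧ ⊆ ⟦ L - j ⟧ ∪ ⟦ C ⟧
    ⟦L⟧⊆ = blockUnion-∪ p (L - j) C ∘ blockUnion-mono p {A = L} (p⊆[p-x]∪q (q⊆p∪q J₀ ⁅ j ⁆ (x∈⁅x⁆ j)))

  -- Removing a block from L strictly lowers ρ while u blocks lie outside L:
  -- take a u-set D₀ disjoint from L; then D₀ ∪ {j} indexes a cocircuit.
  rank-step-strict : ∀ L {j} → j ∈ L → ∣ L ∣ + u ≤ r → ρ (L - j) < ρ L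
  rank-step-strict L {j} j∈L ∣L∣+u≤r with subset-of-size u (∁ L) room | block-element j
    where
    room : u ≤ ∣ ∁ L ∣
    room = subst (u ≤_) (sym (∣∁p∣≡n∸∣p∣ L))
             (subst (_≤ r ∸ ∣ L ∣) (m+n∸m≡n ∣ L ∣ u) (∸-monoˡ-≤ ∣ L ∣ ∣L∣+u≤r))
  ... | D₀ , D₀⊆∁L , ∣D₀∣ | e , pe≡j =
    cocircuit-rank-drop M (proj₂ (t-set D ∣D∣)) e∈⟦L⟧ e∈⟦D⟧ (blockUnion-mono p (p─q⊆p L ⁅ j ⁆)) disjoint
    where
    D : Subset r
    D = D₀ ∪ ⁅ j ⁆
    ∣D∣ : ∣ D ∣ ≡ suc u
    ∣D∣ = insert-size ∣D₀∣ (λ j∈D₀ → x∈∁p⇒x∉p (D₀⊆∁L j∈D₀) j∈L)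
    e∈⟦L⟧ : e ∈ ⟦ L ⟧
    e∈⟦L⟧ = ∈-blockUnion⁺ p (subst (_∈ L) (sym pe≡j) j∈L)
    e∈⟦D⟧ : e ∈ ⟦ D ⟧
    e∈⟦D⟧ = ∈-blockUnion⁺ p (q⊆p∪q D₀ ⁅ j ⁆ (subst (_∈ ⁅ j ⁆) (sym pe≡j) (x∈⁅x⁆ j)))
    disjoint : ∀ {y} → y ∈ ⟦ L - j ⟧ → y ∉ ⟦ D ⟧
    disjoint {y} y∈⟦L-j⟧ y∈⟦D⟧ with x∈p∪q⁻ D₀ ⁅ j ⁆ (∈-blockUnion⁻ p y∈⟦D⟧)
    ... | inj₁ py∈D₀ = x∈∁p⇒x∉p (D₀⊆∁L py∈D₀) (p─q⊆p L ⁅ j ⁆ (∈-blockUnion⁻ p y∈⟦L-j⟧))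
    ... | inj₂ py∈⁅j⁆ = x∉p-x L j (subst (_∈ L - j) (x∈⁅y⁆⇒x≡y j py∈⁅j⁆) (∈-blockUnion⁻ p y∈⟦L-j⟧))

  rank-at-u : ∀ L → ∣ L ∣ ≡ u → ρ L ≡ ∣ L ∣ + u
  rank-at-u L ∣L∣≡u = trans (independent-below-t L (subst (_< suc u) (sym ∣L∣≡u) ≤-refl))
                            (cong (∣ L ∣ +_) (trans (+-identityʳ ∣ L ∣) ∣L∣≡u))

  upper-bound : ∀ L → u ≤ ∣ L ∣ → ρ L ≤ ∣ L ∣ + u
  upper-bound = removal-induction u (λ L → ρ L ≤ ∣ L ∣ + u) (λ L → ≤-reflexive ∘ rank-at-u L) step
    where
    step : ∀ L j → j ∈ L → u ≤ ∣ L - j ∣ → ρ (L - j) ≤ ∣ L - j ∣ + u → ρ L ≤ ∣ L ∣ + u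
    step L j j∈L u≤∣L-j∣ ih = begin
      ρ L                 ≤⟨ rank-step-≤1 L j∈L u≤∣L-j∣ ⟩
      suc (ρ (L - j))     ≤⟨ s≤s ih ⟩
      suc ∣ L - j ∣ + u   ≡⟨ cong (_+ u) (∣p-x∣+1≡∣p∣ j∈L) ⟩
      ∣ L ∣ + u           ∎
      where open ≤-Reasoning

  lower-bound : ∀ L → u ≤ ∣ L ∣ → ∣ L ∣ + u ≤ r → ∣ L ∣ + u ≤ ρ L
  lower-bound = removal-induction u (λ L → ∣ L ∣ + u ≤ r → ∣ L ∣ + u ≤ ρ L)
                  (λ L ∣L∣≡u _ → ≤-reflexive (sym (rank-at-u L ∣L∣≡u))) step
    where
    step : ∀ L j → j ∈ L → u ≤ ∣ L - j ∣ → (∣ L - j ∣ + u ≤ r → ∣ L - j ∣ + u ≤ ρ (L - j)) →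
           ∣ L ∣ + u ≤ r → ∣ L ∣ + u ≤ ρ L
    step L j j∈L _ ih ∣L∣+u≤r = begin
      ∣ L ∣ + u           ≡⟨ cong (_+ u) (sym (∣p-x∣+1≡∣p∣ j∈L)) ⟩
      suc ∣ L - j ∣ + u   ≤⟨ s≤s (ih (≤-trans (+-monoˡ-≤ u (∣p─q∣≤∣p∣ L ⁅ j ⁆)) ∣L∣+u≤r)) ⟩
      suc (ρ (L - j))     ≤⟨ rank-step-strict L j∈L ∣L∣+u≤r ⟩
      ρ L                 ∎
      where open ≤-Reasoning

  rank-exact : ∀ L → u ≤ ∣ L ∣ → ∣ L ∣ + u ≤ r → ρ L ≡ ∣ L ∣ + u
  rank-exact L u≤∣L∣ ∣L∣+u≤r = ≤-antisym (upper-bound L u≤∣L∣) (lower-bound L u≤∣L∣ ∣L∣+u≤r)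

  complement-rank : ∀ J → rank M (∁ ⟦ J ⟧) ≡ ρ (∁ J)
  complement-rank J = cong (rank M) (sym (blockUnion-∁ p J))

  -- If r ≥ 2u the spike has rank r: the complement K of a u-set of blocks
  -- is spanning and has ρ K = (r − u) + u.
  full-rank : u + u ≤ r → rank M ⊤ ≡ r
  full-rank u+u≤r with subset-of-size u ⊤ (subst (u ≤_) (sym (∣⊤∣≡n r)) (≤-trans (n≤1+n u) t≤r))
  ... | U , _ , ∣U∣ = begin
    rank M ⊤          ≡⟨ sym (spanning-below-t U (subst (_< suc u) (sym ∣U∣) ≤-refl)) ⟩
    rank M (∁ ⟦ U ⟧)  ≡⟨ complement-rank U ⟩
    ρ (∁ U)           ≡⟨ rank-exact (∁ U) u≤∣∁U∣ (≤-reflexive ∣∁U∣+u≡r) ⟩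
    ∣ ∁ U ∣ + u       ≡⟨ ∣∁U∣+u≡r ⟩
    r                 ∎
    where
    open ≡-Reasoning
    ∣∁U∣ : ∣ ∁ U ∣ ≡ r ∸ u
    ∣∁U∣ = trans (∣∁p∣≡n∸∣p∣ U) (cong (r ∸_) ∣U∣)
    ∣∁U∣+u≡r : ∣ ∁ U ∣ + u ≡ r
    ∣∁U∣+u≡r = trans (cong (_+ u) ∣∁U∣) (m∸n+n≡m (≤-trans (n≤1+n u) t≤r))
    u≤∣∁U∣ : u ≤ ∣ ∁ U ∣
    u≤∣∁U∣ = subst (u ≤_) (sym ∣∁U∣) (subst (_≤ r ∸ u) (m+n∸m≡n u u) (∸-monoˡ-≤ u u+u≤r))

lemma6p4 : (t r n : ℕ) (M : Matroid n) (p : Fin n → Fin r) →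
    1 ≤ t → IsSpike t r M p →
    (J : Subset r) → ∣ J ∣ ≤ ∣ ∁ J ∣ →
    (∣ J ∣ < t → conn M (blockUnion p J) ≡ 2 * ∣ J ∣) ×
    (t ≤ ∣ J ∣ → conn M (blockUnion p J) ≡ 2 * t ∸ 2)
lemma6p4 zero r n M p () spike J ∣J∣≤∣∁J∣
lemma6p4 (suc u) r n M p _ spike J ∣J∣≤∣∁J∣ = below-t , from-t
  where
  open SpikeRank u M p spike
  open ≡-Reasoning

  below-t : ∣ J ∣ < suc u → conn M ⟦ J ⟧ ≡ 2 * ∣ J ∣
  below-t J<t = begin
    ρ J + rank M (∁ ⟦ J ⟧) ∸ rank M ⊤ ≡⟨ cong₂ (λ a b → a + b ∸ rank M ⊤) (independent-below-t J J<t) (spanning-below-t J J<t) ⟩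
    2 * ∣ J ∣ + rank M ⊤ ∸ rank M ⊤   ≡⟨ m+n∸n≡m (2 * ∣ J ∣) (rank M ⊤) ⟩
    2 * ∣ J ∣                         ∎

  from-t : suc u ≤ ∣ J ∣ → conn M ⟦ J ⟧ ≡ 2 * suc u ∸ 2
  from-t t≤∣J∣ = begin
    ρ J + rank M (∁ ⟦ J ⟧) ∸ rank M ⊤                  ≡⟨ cong₂ _∸_ (cong₂ _+_ ρJ ρ∁J) (full-rank u+u≤r) ⟩
    (∣ J ∣ + u) + (∣ ∁ J ∣ + u) ∸ r                    ≡⟨ cong ((∣ J ∣ + u) + (∣ ∁ J ∣ + u) ∸_) (sym (∣p∣+∣∁p∣≡n J)) ⟩
    (∣ J ∣ + u) + (∣ ∁ J ∣ + u) ∸ (∣ J ∣ + ∣ ∁ J ∣)    ≡⟨ connectivity-arith ∣ J ∣ ∣ ∁ J ∣ u ⟩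
    2 * suc u ∸ 2                                      ∎
    where
    u≤∣J∣ : u ≤ ∣ J ∣
    u≤∣J∣ = ≤-trans (n≤1+n u) t≤∣J∣
    u≤∣∁J∣ : u ≤ ∣ ∁ J ∣
    u≤∣∁J∣ = ≤-trans u≤∣J∣ ∣J∣≤∣∁J∣
    ρJ : ρ J ≡ ∣ J ∣ + u
    ρJ = rank-exact J u≤∣J∣ (subst (∣ J ∣ + u ≤_) (∣p∣+∣∁p∣≡n J) (+-monoʳ-≤ ∣ J ∣ u≤∣∁J∣))
    ρ∁J : rank M (∁ ⟦ J ⟧) ≡ ∣ ∁ J ∣ + u
    ρ∁J = trans (complement-rank J) (rank-exact (∁ J) u≤∣∁J∣
            (subst (∣ ∁ J ∣ + u ≤_) (trans (+-comm ∣ ∁ J ∣ ∣ J ∣) (∣p∣+∣∁p∣≡n J)) (+-monoʳ-≤ ∣ ∁ J ∣ u≤∣J∣)))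
    u+u≤r : u + u ≤ r
    u+u≤r = subst (u + u ≤_) (∣p∣+∣∁p∣≡n J) (+-mono-≤ u≤∣J∣ u≤∣∁J∣)
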